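{- Let $f:B\to A$ and $g:C\to A$ be two covers, and let $B\xleftarrow{p}U\xrightarrow{q}C$ be a pullback of $B\xrightarrow{f}A\xleftarrow{g}C$. If $k$ is a cover with codomain $B$ such that $g\sqsubseteq f\circ k$, then $|{\rm Hom}(f\circ k,g)|\le|{\rm Hom}(k,p)|$.
   Context: Let $\mathbf C$ be a category and $\mathbf D$ a full subcategory of $\mathbf C$. For arrows $f,g$ of $\mathbf C$ with ${\rm cod}\,f={\rm cod}\,g$, ${\rm Hom}(g,f)$ denotes the collection of all arrows $h$ of $\mathbf C$ with $g=f\circ h$. Standing assumptions: (G1) every diagram $B\to A\leftarrow C$ in $\mathbf D$ has a pullback in $\mathbf C$. (G2) (I) pushouts exist in $\mathbf D$; (II) every arrow of $\mathbf D$ is epic; (III) every monic arrow of $\mathbf D$ is an isomorphism whose inverse is an arrow of $\mathbf D$. (G3) for every object $U$ of $\mathbf C$ there is a set $\Sigma(U)$ of arrows $i$ of $\mathbf C$ with ${\rm dom}\,i$ in $\mathbf D$ and ${\rm cod}\,i=U$ such that for every arrow $u$ of $\mathbf C$ with ${\rm dom}\,u$ in $\mathbf D$ and ${\rm cod}\,u=U$ there is exactly one $i\in\Sigma(U)$ with ${\rm Hom}(u,i)\neq\emptyset$. (G4) there is a function $\deg$ from the collection of arrows of $\mathbf C$ whose codomain lies in $\mathbf D$ to the positive integers such that (I) $\deg(g\circ f)=\deg g\cdot\deg f$ whenever $f,g,g\circ f$ all lie in this collection; (II) $\deg f=\sum_{i\in\Sigma({\rm dom}\,f)}\deg(f\circ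 i)$ for every such $f$; (III) if $B\xrightarrow{f}A\xleftarrow{g}C$ is a diagram in $\mathbf D$ with pullback $B\xleftarrow{p}U\xrightarrow{q}C$, then $\deg f=\deg q$ and $\deg g=\deg p$. A cover is an arrow of $\mathbf D$. Write $f\sqsubseteq g$ if ${\rm cod}\,f={\rm cod}\,g$ and ${\rm Hom}(g,f)\neq\emptyset$. -}

module Defs where

open import Level using (Level; _⊔_) renaming (suc to lsuc)
open import Data.Nat using (ℕ; _*_; _+_; _≤_; zero; suc)
open import Data.Fin using (Fin) renaming (zero to fzero; suc to fsuc)
open import Data.Product using (Σ; ∃; _×_; _,_; proj₁; proj₂)
open import Relation.Binary.PropositionalEquality using (_≡_)
open import Relation.Nullary using (¬_)

∑ : (n : ℕ) → (Fin n → ℕ) → ℕ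
∑ zero    a = 0
∑ (suc n) a = a fzero + ∑ n (λ i → a (fsuc i))

record Category (o ℓ : Level) : Set (lsuc (o ⊔ ℓ)) where
  infixr 9 _∘_
  field
    Obj       : Set o
    Hom       : Obj → Obj → Set ℓ
    id        : ∀ {A} → Hom A A
    _∘_       : ∀ {A B C} → Hom B C → Hom A B → Hom A C
    assoc     : ∀ {A B C D} (f : Hom A B) (g : Hom B C) (h : Hom C D) →
                (h ∘ g) ∘ f ≡ h ∘ (g ∘ f)
    identityˡ : ∀ {A B} (f : Hom A B) → id ∘ f ≡ f
    identityʳ : ∀ {A B} (f : Hom A B) → f ∘ id ≡ f

  -- Hom(g,f) = { h | g = f ∘ h }  for f : X → A, g : Y → A.
  HomOver : ∀ {X Y A} → Hom Y A → Hom X A → Set ℓ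
  HomOver {X} {Y} g f = Σ (Hom Y X) (λ h → g ≡ f ∘ h)

  _⊑_ : ∀ {X Y A} → Hom X A → Hom Y A → Set ℓ
  f ⊑ g = HomOver g f

  -- |Hom(g,f)| ≤ |Hom(g',f')| : an injection (on the underlying arrows)
  _≲_ : ∀ {X Y A X' Y' A'} → (Hom Y A × Hom X A) → (Hom Y' A' × Hom X' A') → Set ℓ
  (g , f) ≲ (g' , f') =
    Σ (HomOver g f → HomOver g' f') λ F →
      ∀ x y → proj₁ (F x) ≡ proj₁ (F y) → proj₁ x ≡ proj₁ y

  record Pullback {A B C : Obj} (f : Hom B A) (g : Hom C A) : Set (o ⊔ ℓ) where
    field
      P        : Obj
      p        : Hom P B
      q        : Hom P C
      commute  : f ∘ p ≡ g ∘ q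
      universal : ∀ {X} (h₁ : Hom X B) (h₂ : Hom X C) → f ∘ h₁ ≡ g ∘ h₂ →
                  Σ (Hom X P) λ u → (p ∘ u ≡ h₁) × (q ∘ u ≡ h₂) ×
                    (∀ (v : Hom X P) → p ∘ v ≡ h₁ → q ∘ v ≡ h₂ → v ≡ u)

-- The standing assumptions (G1)–(G4) for a category C and a full
-- subcategory D (given by a predicate on objects; D-arrows = all C-arrows
-- between D-objects).
record Setting (o ℓ d : Level) : Set (lsuc (o ⊔ ℓ ⊔ d)) where
  field
    C : Category o ℓ
  open Category C public
  field
    D : Obj → Set d

  MonicD : ∀ {A B} → Hom A B → Set (o ⊔ ℓ ⊔ d)
  MonicD {A} f = ∀ {X} → D X → (u v : Hom X A) → f ∘ u ≡ f ∘ v → u ≡ v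
  EpicD : ∀ {A B} → Hom A B → Set (o ⊔ ℓ ⊔ d)
  EpicD {B = B} f = ∀ {X} → D X → (u v : Hom B X) → u ∘ f ≡ v ∘ f → u ≡ v

  field
    G1 : ∀ {A B C'} → D A → D B → D C' → (f : Hom B A) (g : Hom C' A) → Pullback f g
    G2-I : ∀ {A B C'} → D A → D B → D C' → (f : Hom A B) (g : Hom A C') →
           Σ Obj λ Q → D Q × Σ (Hom B Q) λ i₁ → Σ (Hom C' Q) λ i₂ →
             (i₁ ∘ f ≡ i₂ ∘ g) ×
             (∀ {X} → D X → (h₁ : Hom B X) (h₂ : Hom C' X) → h₁ ∘ f ≡ h₂ ∘ g →
               Σ (Hom Q X) λ u → (u ∘ i₁ ≡ h₁) × (u ∘ i₂ ≡ h₂) ×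
                 (∀ v → v ∘ i₁ ≡ h₁ → v ∘ i₂ ≡ h₂ → v ≡ u))
    G2-II : ∀ {A B} → D A → D B → (f : Hom A B) → EpicD f
    -- (G2)(III) every monic arrow of D is an isomorphism (inverse is in D by fullness)
    G2-III : ∀ {A B} → D A → D B → (f : Hom A B) → MonicD f →
             Σ (Hom B A) λ g → (g ∘ f ≡ id) × (f ∘ g ≡ id)
    -- (G3) the sets Σ(U), finite-indexed (finiteness is forced by (G4)(II))
    Σn   : Obj → ℕ
    Σdom : ∀ U → Fin (Σn U) → Obj
    ΣD   : ∀ U i → D (Σdom U i)
    Σarr : ∀ U i → Hom (Σdom U i) U
    G3   : ∀ {U X} → D X → (u : Hom X U) →
           Σ (Fin (Σn U)) λ i → HomOver u (Σarr U i) ×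
             (∀ j → HomOver u (Σarr U j) → j ≡ i)
    deg     : ∀ {X A} → D A → Hom X A → ℕ
    deg-pos : ∀ {X A} (dA : D A) (f : Hom X A) → 1 ≤ deg dA f
    G4-I    : ∀ {X Y A} (dY : D Y) (dA : D A) (f : Hom X Y) (g : Hom Y A) →
              deg dA (g ∘ f) ≡ deg dA g * deg dY f
    G4-II   : ∀ {X A} (dA : D A) (f : Hom X A) →
              deg dA f ≡ ∑ (Σn X) (λ i → deg dA (f ∘ Σarr X i))
    G4-III  : ∀ {A B C'} (dA : D A) (dB : D B) (dC : D C') (f : Hom B A) (g : Hom C' A)
              (pb : Pullback f g) →
              (deg dA f ≡ deg dC (Pullback.q pb)) × (deg dA g ≡ deg dB (Pullback.p pb))

{-# OPTIONS --safe #-}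
module Submission where

-- An arrow h with g ∘ h = f ∘ k is a cone (k , h) over f and g, hence factors
-- through the pullback by a mediating arrow u with p ∘ u = k; since q ∘ u = h,
-- the assignment h ↦ u is injective.

open import Data.Product using (_,_; proj₁; proj₂)
open import Relation.Binary.PropositionalEquality using (_≡_; sym; trans; cong)
open import Defs

module _ {o ℓ} (𝒞 : Category o ℓ) where
  open Category 𝒞

  module _ {A B C K} {f : Hom B A} {g : Hom C A} (pb : Pullback f g) (k : Hom K B) where
    open Pullback pb

    mediate : HomOver (f ∘ k) g → HomOver k p
    mediate (h , e) = let (u , pu , _) = universal k h e in u , sym pu

    q∘mediate : ∀ x → q ∘ proj₁ (mediate x) ≡ proj₁ x
    q∘mediate (h , e) = proj₁ (proj₂ (proj₂ (universal k h e)))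

    mediate-injective : ∀ x y → proj₁ (mediate x) ≡ proj₁ (mediate y) → proj₁ x ≡ proj₁ y
    mediate-injective x y eq =
      trans (sym (q∘mediate x)) (trans (cong (q ∘_) eq) (q∘mediate y))

    HomOver-≲-pullback : ((f ∘ k) , g) ≲ (k , p)
    HomOver-≲-pullback = mediate , mediate-injective

lemma4p12 : ∀ {o ℓ d} (S : Setting o ℓ d) → let open Setting S in
    ∀ {A B C' K} (dA : D A) (dB : D B) (dC : D C') (dK : D K)
    (f : Hom B A) (g : Hom C' A) (pb : Pullback f g) (k : Hom K B) →
    g ⊑ (f ∘ k) →
    ((f ∘ k) , g) ≲ (k , Pullback.p pb)
lemma4p12 S _ _ _ _ _ _ pb k _ = HomOver-≲-pullback (Setting.C S) pb k
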